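{- Let $\mathcal{G}$ be a (non-degenerate) $[n,k,d]_q$ A$^s$MDS code with $k\ge 2$. \begin{enumerate} \item If $s=0$ then $\mathcal{G}$ is projective. \item If $k=2$ then $\mathcal{G}$ is projective if and only if $s=0$. \item If $s>0$, $k>2$ and $n>m^{s-1}(k-1,q)+2$, then $\mathcal{G}$ is projective. \item If $k>2$ and $n>s(q+1)+k-1$, then $\mathcal{G}$ is projective. \item If $s=1$, $k>q$ and $n>k+2$, then $\mathcal{G}$ is projective. \end{enumerate}
   Context: A linear $[n,k,d]_q$ code is identified with a projective system: a finite multiset $\mathcal{G}$ of $n$ points (counted with multiplicity) of $\mathrm{PG}(k-1,q)$, not all lying in one hyperplane, with $n-d=\max_H|\mathcal{G}\cap H|$ over hyperplanes $H$ (counted with multiplicity); equivalently, the columns of a generator matrix of a non-degenerate linear code of length $n$, dimension $k$, minimum distance $d$ over $\mathbb{F}_q$. The Singleton defect is $S(\mathcal{G})=n-k+1-d$; $\mathcal{G}$ is A$^s$MDS if $S(\mathcal{G})=s$. The code is projective if $\mathcal{G}$ is a set, i.e. every point has multiplicity $1$. $m^s(k,q)$ denotes the maximum length $n$ of a non-degenerate $[n,k,d]_q$ A$^s$MDS code. -}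

module Defs where

open import Level using (0ℓ)
open import Data.Nat using (ℕ; zero; suc; _≤_) renaming (_+_ to _+ℕ_)
open import Data.Fin using (Fin; zero; suc)
open import Data.Product using (Σ; _×_; _,_)
open import Relation.Nullary using (¬_; Dec; yes; no)
open import Relation.Binary.PropositionalEquality using (_≡_)
open import Relation.Binary.Definitions using (DecidableEquality)
open import Algebra.Structures using (IsCommutativeRing)
open import Function.Bundles using (_↔_)

record FiniteField (q : ℕ) : Set₁ where
  field
    Carrier : Set
    _+_ : Carrier → Carrier → Carrier
    _*_ : Carrier → Carrier → Carrier
    -_  : Carrier → Carrier
    0#  : Carrier
    1#  : Carrier
    isCommutativeRing : IsCommutativeRing _≡_ _+_ _*_ -_ 0# 1#
    0≢1 : ¬ (0# ≡ 1#)
    inverse : (x : Carrier) → ¬ (x ≡ 0#) → Σ Carrier (λ y → (x * y) ≡ 1#)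
    _≟_ : DecidableEquality Carrier
    enumeration : Carrier ↔ Fin q

module _ {q : ℕ} (F : FiniteField q) where
  open FiniteField F

  ∑ : (k : ℕ) → (Fin k → Carrier) → Carrier
  ∑ zero f = 0#
  ∑ (suc k) f = f zero + ∑ k (λ i → f (suc i))

  count : (n : ℕ) → {P : Fin n → Set} → ((j : Fin n) → Dec (P j)) → ℕ
  count zero P? = 0
  count (suc n) P? with P? zero
  ... | yes _ = suc (count n (λ j → P? (suc j)))
  ... | no  _ = count n (λ j → P? (suc j))

  Vect : ℕ → Set
  Vect k = Fin k → Carrier

  IsZeroVec : {k : ℕ} → Vect k → Set
  IsZeroVec {k} v = (t : Fin k) → v t ≡ 0#

  ⟨_,_⟩ : {k : ℕ} → Vect k → Vect k → Carrier
  ⟨_,_⟩ {k} u v = ∑ k (λ t → u t * v t)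

  -- A multiset of n points of PG(k-1,q), given by representative
  -- (nonzero) vectors in F^k; point j has representative P j.
  -- (These are the columns of a generator matrix.)
  PointFamily : ℕ → ℕ → Set
  PointFamily n k = Fin n → Vect k

  AllPoints : {n k : ℕ} → PointFamily n k → Set
  AllPoints {n} P = (j : Fin n) → ¬ IsZeroVec (P j)

  -- |G ∩ H| counted with multiplicity, for the hyperplane H = ker u (u ≠ 0)
  hyperplaneCount : {n k : ℕ} → PointFamily n k → Vect k → ℕ
  hyperplaneCount {n} P u = count n (λ j → ⟨ u , P j ⟩ ≟ 0#)

  NonDegenerate : {n k : ℕ} → PointFamily n k → Set
  NonDegenerate {n} {k} P =
    (u : Vect k) → ¬ IsZeroVec u → Σ (Fin n) (λ j → ¬ (⟨ u , P j ⟩ ≡ 0#))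

  -- n - d = max over hyperplanes H of |G ∩ H|
  HasMinDist : {n k : ℕ} → PointFamily n k → ℕ → Set
  HasMinDist {n} {k} P d =
    Σ (Vect k) (λ u → ¬ IsZeroVec u × (hyperplaneCount P u +ℕ d ≡ n))
    × ((u : Vect k) → ¬ IsZeroVec u → hyperplaneCount P u +ℕ d ≤ n)

  IsProjSystem : (n k d : ℕ) → PointFamily n k → Set
  IsProjSystem n k d P = AllPoints P × NonDegenerate P × HasMinDist P d

  -- Singleton defect S(G) = n - k + 1 - d equals s  (stated additively;
  -- n - k + 1 - d ≥ 0 by the Singleton bound)
  IsAsMDS : (s n k d : ℕ) → Set
  IsAsMDS s n k d = n +ℕ 1 ≡ s +ℕ k +ℕ d

  SamePoint : {k : ℕ} → Vect k → Vect k → Set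
  SamePoint {k} v w = Σ Carrier (λ λ' → ¬ (λ' ≡ 0#) × ((t : Fin k) → v t ≡ λ' * w t))

  Projective : {n k : ℕ} → PointFamily n k → Set
  Projective {n} P = (i j : Fin n) → SamePoint (P i) (P j) → i ≡ j

  ExistsAsMDS : (s k n : ℕ) → Set
  ExistsAsMDS s k n =
    Σ ℕ (λ d → Σ (PointFamily n k) (λ P → IsProjSystem n k d P × IsAsMDS s n k d))

  IsMaxLength : (s k m : ℕ) → Set
  IsMaxLength s k m = ExistsAsMDS s k m × ((n : ℕ) → ExistsAsMDS s k n → n ≤ m)

-- A repeated point P = G i = λ G j counts twice on every hyperplane through P, while an
-- A^sMDS code has at most s + k - 1 points on any hyperplane.
-- (i)   P and k - 2 further points lie on a hyperplane, which then holds k points.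
-- (ii)  On the projective line hyperplanes are points, so the fullest hyperplane, holding
--       s + 1 points, is a repeated point unless s = 0.
-- (iii) Projecting the other n - 2 points from P gives a spanning family in dimension k - 1
--       with at most s + k - 3 points on each hyperplane; replacing its zero vectors and
--       adding copies of a point of its fullest hyperplane makes it an A^(s-1)MDS code of
--       length at least n - 2, so n - 2 ≤ m^(s-1)(k-1,q).
-- (iv)  The q + 1 hyperplanes of a pencil whose axis holds P twice and k - 3 further points
--       cover every point once and the axis q + 1 times: n + q(k - 1) ≤ (q + 1)(s + k - 1).
-- (v)   For s = 1 pick further points a, b, p₁, …, p_(k-1) and let h_m pass through P and
--       every p except p_m; being full, h_m misses a, b and p_m. As k - 1 ≥ q, two of the
--       ratios ⟨h_m, b⟩ / ⟨h_m, a⟩ ∈ F* agree, and the combination of those two hyperplanes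
--       through a also passes through b: a hyperplane with k + 1 points.
module Submission where

open import Algebra.Bundles using (CommutativeRing)
import Algebra.Properties.Semiring.Sum as SemiringSum
open import Data.Bool using (Bool; true; false; _∧_)
open import Data.Bool.Properties using (∧-zeroʳ)
open import Data.Empty using (⊥; ⊥-elim)
open import Data.Fin using (Fin; zero; suc; punchIn; punchOut; inject≤; splitAt; _↑ʳ_)
import Data.Fin.Properties as Finₚ
open import Data.Nat as ℕ using (ℕ; zero; suc; z≤n; s≤s; _≤_; _<_; _∸_)
import Data.Nat.Properties as ℕₚ
open import Data.Product using (Σ; Σ-syntax; ∃; ∃₂; _×_; _,_; proj₁; proj₂)
open import Data.Sum using (inj₁; inj₂; [_,_])
open import Data.Sum.Properties using ([,]-map)
open import Data.Vec.Functional using (_∷_; _++_; tail; insertAt; replicate)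
open import Data.Vec.Functional.Properties using (insertAt-lookup; insertAt-punchIn; lookup-++ʳ)
open import Function using (_∘_)
open import Function.Bundles using (Inverse; _⇔_; mk⇔)
open import Function.Definitions using (Injective)
open import Level using (0ℓ)
open import Relation.Binary.PropositionalEquality
  using (_≡_; _≢_; refl; sym; trans; cong; cong₂; subst; subst₂; module ≡-Reasoning)
open import Relation.Nullary using (¬_; Dec; does; yes; no; ¬?)
open import Relation.Nullary.Decidable using (decidable-stable; dec-true; dec-false; _×-dec_)

open import Defs hiding (⟨_,_⟩)
import Defs

open SemiringSum ℕₚ.+-*-semiring using (sum; sum-cong-≗; sum-remove; ∑-distrib-+; ∑-comm; *-distribˡ-sum)

module Combinatorics where

  open import Data.Nat using (_+_; _*_)
  open import Data.Nat.Solver using (module +-*-Solver)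
  open ℕₚ using (+-mono-≤; +-monoʳ-≤; +-cancelʳ-≤; +-assoc; ≤-refl; ≤-trans; ≤-pred; ≤∧≢⇒<; m≤n+m;
                 module ≤-Reasoning)

  𝟙 : Bool → ℕ
  𝟙 true  = 1
  𝟙 false = 0

  𝟙≤1 : ∀ b → 𝟙 b ≤ 1
  𝟙≤1 true  = s≤s z≤n
  𝟙≤1 false = z≤n

  countTrue : ∀ {n} → (Fin n → Bool) → ℕ
  countTrue f = sum (𝟙 ∘ f)

  countTrue-cong : ∀ {n} {f g : Fin n → Bool} → (∀ i → f i ≡ g i) → countTrue f ≡ countTrue g
  countTrue-cong f≗g = sum-cong-≗ (cong 𝟙 ∘ f≗g)

  countTrue-remove : ∀ {n} (t : Fin (suc n)) (f : Fin (suc n) → Bool) →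
                     countTrue f ≡ 𝟙 (f t) + countTrue (f ∘ punchIn t)
  countTrue-remove t f = sum-remove {i = t} (𝟙 ∘ f)

  sum-const : ∀ n c → sum {n} (λ _ → c) ≡ n * c
  sum-const zero    c = refl
  sum-const (suc n) c = cong (c +_) (sum-const n c)

  sum-mono-≤ : ∀ {n} {f g : Fin n → ℕ} → (∀ i → f i ≤ g i) → sum f ≤ sum g
  sum-mono-≤ {zero}  f≤g = z≤n
  sum-mono-≤ {suc n} f≤g = +-mono-≤ (f≤g zero) (sum-mono-≤ (f≤g ∘ suc))

  countTrue≤n : ∀ {n} (f : Fin n → Bool) → countTrue f ≤ n
  countTrue≤n {zero}  f = z≤n
  countTrue≤n {suc n} f = +-mono-≤ (𝟙≤1 (f zero)) (countTrue≤n (f ∘ suc))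

  countTrue-all : ∀ {n} (f : Fin n → Bool) → (∀ i → f i ≡ true) → countTrue f ≡ n
  countTrue-all {zero}  f all = refl
  countTrue-all {suc n} f all rewrite all zero = cong suc (countTrue-all (f ∘ suc) (all ∘ suc))

  countTrue-mono : ∀ {n} {f g : Fin n → Bool} → (∀ i → f i ≡ true → g i ≡ true) →
                   countTrue f ≤ countTrue g
  countTrue-mono {zero}  f⇒g = z≤n
  countTrue-mono {suc n} f⇒g = +-mono-≤ (𝟙-mono (f⇒g zero)) (countTrue-mono (f⇒g ∘ suc))
    where
    𝟙-mono : ∀ {a b} → (a ≡ true → b ≡ true) → 𝟙 a ≤ 𝟙 b
    𝟙-mono {true}  a⇒b rewrite a⇒b refl = ≤-refl
    𝟙-mono {false} a⇒b = z≤n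

  countTrue-pos : ∀ {n} (f : Fin n → Bool) (t : Fin n) → f t ≡ true → 0 < countTrue f
  countTrue-pos {suc n} f t ft≡true rewrite countTrue-remove t f | ft≡true = s≤s z≤n

  countTrue<n : ∀ {n} (f : Fin n → Bool) (t : Fin n) → f t ≡ false → countTrue f < n
  countTrue<n {suc n} f t ft≡false rewrite countTrue-remove t f | ft≡false =
    s≤s (countTrue≤n (f ∘ punchIn t))

  countTrue-punchIn : ∀ {n} (f : Fin (suc n) → Bool) (t : Fin (suc n)) →
                      (∀ i → f (punchIn t i) ≡ true) → n ≤ countTrue f
  countTrue-punchIn f t all rewrite countTrue-remove t f | countTrue-all (f ∘ punchIn t) all =
    m≤n+m _ _

  countTrue-∘-injective : ∀ {c n} (f : Fin n → Bool) (g : Fin c → Fin n) → Injective _≡_ _≡_ g →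
                          countTrue (f ∘ g) ≤ countTrue f
  countTrue-∘-injective {zero}           f g g-inj = z≤n
  countTrue-∘-injective {suc c} {zero}   f g g-inj with g zero
  ... | ()
  countTrue-∘-injective {suc c} {suc n} f g g-inj
    rewrite countTrue-remove (g zero) f =
    +-monoʳ-≤ (𝟙 (f (g zero))) (begin
      countTrue (f ∘ g ∘ suc)                     ≡⟨ countTrue-cong (cong f ∘ sym ∘ g∘suc≡) ⟩
      countTrue (f ∘ punchIn (g zero) ∘ g′)       ≤⟨ countTrue-∘-injective (f ∘ punchIn (g zero)) g′ g′-inj ⟩
      countTrue (f ∘ punchIn (g zero))            ∎)
    where
    open ≤-Reasoning
    g₀≢ : ∀ x → g zero ≢ g (suc x)
    g₀≢ x eq with g-inj eq
    ... | ()
    g′ : Fin c → Fin n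
    g′ x = punchOut (g₀≢ x)
    g∘suc≡ : ∀ x → punchIn (g zero) (g′ x) ≡ g (suc x)
    g∘suc≡ x = Finₚ.punchIn-punchOut (g₀≢ x)
    g′-inj : Injective _≡_ _≡_ g′
    g′-inj {x} {y} eq = Finₚ.suc-injective (g-inj
      (trans (sym (g∘suc≡ x)) (trans (cong (punchIn (g zero)) eq) (g∘suc≡ y))))

  countTrue-witness : ∀ {n} (f : Fin n → Bool) → 0 < countTrue f → ∃ λ i → f i ≡ true
  countTrue-witness {suc n} f pos with f zero in f₀
  ... | true  = zero , f₀
  ... | false = let i , fi = countTrue-witness (f ∘ suc) pos in suc i , fi

  countTrue-witness₂ : ∀ {n} (f : Fin n → Bool) → 1 < countTrue f →
                       ∃₂ λ i j → i ≢ j × f i ≡ true × f j ≡ true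
  countTrue-witness₂ {suc n} f >1 with f zero in f₀
  ... | true  = let j , fj = countTrue-witness (f ∘ suc) (≤-pred >1) in zero , suc j , (λ ()) , f₀ , fj
  ... | false = let i , j , i≢j , fi , fj = countTrue-witness₂ (f ∘ suc) >1
                in suc i , suc j , i≢j ∘ Finₚ.suc-injective , fi , fj

  module Others {n : ℕ} {i j : Fin (suc (suc n))} (i≢j : i ≢ j) where

    private
      j′ : Fin (suc n)
      j′ = punchOut i≢j

      punchIn-j′ : punchIn i j′ ≡ j
      punchIn-j′ = Finₚ.punchIn-punchOut i≢j

    others : Fin n → Fin (suc (suc n))
    others = punchIn i ∘ punchIn j′

    others-surjective : ∀ l → l ≢ i → l ≢ j → ∃ λ y → others y ≡ l
    others-surjective l l≢i l≢j = punchOut j′≢l′ , (begin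
        punchIn i (punchIn j′ (punchOut j′≢l′))  ≡⟨ cong (punchIn i) (Finₚ.punchIn-punchOut j′≢l′) ⟩
        punchIn i l′                             ≡⟨ Finₚ.punchIn-punchOut (l≢i ∘ sym) ⟩
        l                                        ∎)
      where
      open ≡-Reasoning
      l′ = punchOut (l≢i ∘ sym)
      j′≢l′ : j′ ≢ l′
      j′≢l′ eq = l≢j (begin
        l             ≡⟨ Finₚ.punchIn-punchOut (l≢i ∘ sym) ⟨
        punchIn i l′  ≡⟨ cong (punchIn i) eq ⟨
        punchIn i j′  ≡⟨ punchIn-j′ ⟩
        j             ∎)

    countTrue-others : (f : Fin (suc (suc n)) → Bool) →
                       countTrue f ≡ 𝟙 (f i) + (𝟙 (f j) + countTrue (f ∘ others))
    countTrue-others f = begin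
      countTrue f                                                ≡⟨ countTrue-remove i f ⟩
      𝟙 (f i) + countTrue (f ∘ punchIn i)
        ≡⟨ cong (𝟙 (f i) +_) (countTrue-remove j′ (f ∘ punchIn i)) ⟩
      𝟙 (f i) + (𝟙 (f (punchIn i j′)) + countTrue (f ∘ others))
        ≡⟨ cong (λ l → 𝟙 (f i) + (𝟙 (f l) + countTrue (f ∘ others))) punchIn-j′ ⟩
      𝟙 (f i) + (𝟙 (f j) + countTrue (f ∘ others))               ∎
      where open ≡-Reasoning

    2+countTrue-others≤ : ∀ {c} (f : Fin (suc (suc n)) → Bool) → f i ≡ true → f j ≡ true →
                          (g : Fin c → Fin n) → Injective _≡_ _≡_ g →
                          2 + countTrue (f ∘ others ∘ g) ≤ countTrue f
    2+countTrue-others≤ f fi fj g g-inj rewrite countTrue-others f | fi | fj =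
      +-monoʳ-≤ 2 (countTrue-∘-injective (f ∘ others) g g-inj)

    2+c≤countTrue : ∀ {c} (f : Fin (suc (suc n)) → Bool) → f i ≡ true → f j ≡ true → (c≤n : c ≤ n) →
                    (∀ x → f (others (inject≤ x c≤n)) ≡ true) → 2 + c ≤ countTrue f
    2+c≤countTrue f fi fj c≤n all =
      subst (λ m → 2 + m ≤ countTrue f) (countTrue-all _ all)
        (2+countTrue-others≤ f fi fj (λ x → inject≤ x c≤n) (Finₚ.inject≤-injective c≤n c≤n _ _))

  ++-suc : ∀ {A : Set} {m n} (xs : Fin (suc m) → A) (ys : Fin n → A) (i : Fin (m + n)) →
           (xs ++ ys) (suc i) ≡ (tail xs ++ ys) i
  ++-suc {m = m} xs ys i = [,]-map (splitAt m i)

  countTrue-++ : ∀ {A : Set} {m n} (f : A → Bool) (xs : Fin m → A) (ys : Fin n → A) →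
                 countTrue (f ∘ (xs ++ ys)) ≡ countTrue (f ∘ xs) + countTrue (f ∘ ys)
  countTrue-++ {m = zero}  f xs ys = refl
  countTrue-++ {m = suc m} f xs ys = begin
    𝟙 (f (xs zero)) + countTrue (λ i → f ((xs ++ ys) (suc i)))
      ≡⟨ cong (𝟙 (f (xs zero)) +_) (countTrue-cong (cong f ∘ ++-suc xs ys)) ⟩
    𝟙 (f (xs zero)) + countTrue (f ∘ (tail xs ++ ys))
      ≡⟨ cong (𝟙 (f (xs zero)) +_) (countTrue-++ f (tail xs) ys) ⟩
    𝟙 (f (xs zero)) + (countTrue (f ∘ tail xs) + countTrue (f ∘ ys))
      ≡⟨ +-assoc (𝟙 (f (xs zero))) _ _ ⟨
    countTrue (f ∘ xs) + countTrue (f ∘ ys)  ∎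
    where open ≡-Reasoning

  ++-all : ∀ {A : Set} {m n} (P : A → Set) (xs : Fin m → A) (ys : Fin n → A) →
           (∀ i → P (xs i)) → (∀ i → P (ys i)) → ∀ i → P ((xs ++ ys) i)
  ++-all {m = m} P xs ys Pxs Pys i = on-either (splitAt m i)
    where
    on-either : ∀ x → P ([ xs , ys ] x)
    on-either (inj₁ x) = Pxs x
    on-either (inj₂ y) = Pys y

  greatest : ∀ B (D : ℕ → Set) → (∀ b → Dec (D b)) → D 0 →
             ∃ λ b → D b × (∀ b′ → b′ ≤ B → D b′ → b′ ≤ b)
  greatest zero    D D? D0 = 0 , D0 , λ b′ b′≤0 _ → b′≤0
  greatest (suc B) D D? D0 with D? (suc B)
  ... | yes DB = suc B , DB , λ b′ b′≤B _ → b′≤B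
  ... | no ¬DB = b , Db , λ b′ b′≤1+B Db′ → b-max b′ (≤-pred (≤∧≢⇒< b′≤1+B λ { refl → ¬DB Db′ })) Db′
    where
    rec = greatest B D D? D0
    b = proj₁ rec
    Db = proj₁ (proj₂ rec)
    b-max = proj₂ (proj₂ rec)

  maximum-attained : ∀ {A : Set} (P : A → Set) (f : A → ℕ) (B : ℕ) →
                     (∀ b → Dec (∃ λ a → P a × b ≤ f a)) → (∀ a → P a → f a ≤ B) → ∃ P →
                     ∃ λ a → P a × (∀ a′ → P a′ → f a′ ≤ f a)
  maximum-attained P f B D? f≤B (a₀ , Pa₀) =
    let b , (a , Pa , b≤fa) , b-max = greatest B (λ b → ∃ λ a → P a × b ≤ f a) D? (a₀ , Pa₀ , z≤n)
    in a , Pa , λ a′ Pa′ → ≤-trans (b-max (f a′) (f≤B a′ Pa′) (a′ , Pa′ , ≤-refl)) b≤fa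

  pencil-bound : ∀ n q s c → n + q * c ≤ q * (s + c) + (s + c) → n ≤ s * (q + 1) + c
  pencil-bound n q s c bound = +-cancelʳ-≤ (q * c) n _ (subst (n + q * c ≤_) (rearrange) bound)
    where
    open +-*-Solver
    rearrange : q * (s + c) + (s + c) ≡ s * (q + 1) + c + q * c
    rearrange = solve 3 (λ q s c → q :* (s :+ c) :+ (s :+ c) := s :* (q :+ con 1) :+ c :+ q :* c) refl q s c

  AsMDS-length : ∀ s K d N → s + suc K + d ≡ N → N + 1 ≡ s + suc (suc K) + d
  AsMDS-length s K d N eq = trans (cong (_+ 1) (sym eq))
    (solve 3 (λ s K d → s :+ (con 1 :+ K) :+ d :+ con 1 := s :+ (con 2 :+ K) :+ d) refl s K d)
    where open +-*-Solver

open Combinatorics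

module Geometry {q : ℕ} (F : FiniteField q) where

  open FiniteField F using (Carrier; 0#; 1#; 0≢1; inverse; _≟_; isCommutativeRing; enumeration)

  ring : CommutativeRing 0ℓ 0ℓ
  ring = record { isCommutativeRing = isCommutativeRing }

  open CommutativeRing ring
    using (_+_; _*_; -_; _-_; +-comm; +-identityʳ; *-comm; *-identityˡ; *-identityʳ; zeroˡ; zeroʳ;
           -‿inverseʳ; semiring; +-group; commutativeSemiring)
  open import Algebra.Properties.Ring (CommutativeRing.ring ring) using (-1*x≈-x; x[y-z]≈xy-xz; -‿distribˡ-*)
  open import Algebra.Properties.Group +-group using (x∙y⁻¹≈ε⇒x≈y; x≈y⇒x∙y⁻¹≈ε)
  open import Algebra.Solver.Ring.NaturalCoefficients.Default commutativeSemiring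
    using (solve; _:=_; _:+_; _:*_; con)
  module ΣF = SemiringSum semiring

  inv : (a : Carrier) → a ≢ 0# → Carrier
  inv a a≢0 = proj₁ (inverse a a≢0)

  *-inverseʳ : (a : Carrier) (a≢0 : a ≢ 0#) → a * inv a a≢0 ≡ 1#
  *-inverseʳ a a≢0 = proj₂ (inverse a a≢0)

  x*y⁻¹*y≡x : ∀ x {y} (y≢0 : y ≢ 0#) → x * inv y y≢0 * y ≡ x
  x*y⁻¹*y≡x x {y} y≢0 = begin
    x * inv y y≢0 * y    ≡⟨ solve 3 (λ x y z → x :* z :* y := x :* (y :* z)) refl x y _ ⟩
    x * (y * inv y y≢0)  ≡⟨ cong (x *_) (*-inverseʳ y y≢0) ⟩
    x * 1#               ≡⟨ *-identityʳ x ⟩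
    x                    ∎
    where open ≡-Reasoning

  *-cancelˡ-0 : ∀ {a} x → a ≢ 0# → a * x ≡ 0# → x ≡ 0#
  *-cancelˡ-0 {a} x a≢0 ax≡0 = begin
    x              ≡⟨ *-identityˡ x ⟨
    1# * x         ≡⟨ cong (_* x) (*-inverseʳ a a≢0) ⟨
    a * a⁻¹ * x    ≡⟨ solve 3 (λ a b x → (a :* b) :* x := b :* (a :* x)) refl a a⁻¹ x ⟩
    a⁻¹ * (a * x)  ≡⟨ cong (a⁻¹ *_) ax≡0 ⟩
    a⁻¹ * 0#       ≡⟨ zeroʳ a⁻¹ ⟩
    0#             ∎
    where
    open ≡-Reasoning
    a⁻¹ = inv a a≢0

  *-nonzero : ∀ {a b} → a ≢ 0# → b ≢ 0# → a * b ≢ 0#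
  *-nonzero a≢0 b≢0 ab≡0 = b≢0 (*-cancelˡ-0 _ a≢0 ab≡0)

  inv-nonzero : (a : Carrier) (a≢0 : a ≢ 0#) → inv a a≢0 ≢ 0#
  inv-nonzero a a≢0 a⁻¹≡0 = 0≢1 (begin
    0#               ≡⟨ zeroʳ a ⟨
    a * 0#           ≡⟨ cong (a *_) a⁻¹≡0 ⟨
    a * inv a a≢0    ≡⟨ *-inverseʳ a a≢0 ⟩
    1#               ∎)
    where open ≡-Reasoning

  cross-multiply : ∀ {x y z w} (y≢0 : y ≢ 0#) (w≢0 : w ≢ 0#) →
                   x * inv y y≢0 ≡ z * inv w w≢0 → w * x ≡ y * z
  cross-multiply {x} {y} {z} {w} y≢0 w≢0 eq = begin
    w * x                    ≡⟨ cong (w *_) (x*y⁻¹*y≡x x y≢0) ⟨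
    w * (x * inv y y≢0 * y)  ≡⟨ cong (λ c → w * (c * y)) eq ⟩
    w * (z * inv w w≢0 * y)  ≡⟨ solve 4 (λ w z v y → w :* (z :* v :* y) := z :* v :* w :* y) refl w z _ y ⟩
    z * inv w w≢0 * w * y    ≡⟨ cong (_* y) (x*y⁻¹*y≡x z w≢0) ⟩
    z * y                    ≡⟨ *-comm z y ⟩
    y * z                    ∎
    where open ≡-Reasoning

  Vec : ℕ → Set
  Vec = Vect F

  Nonzero : ∀ {k} → Vec k → Set
  Nonzero u = ¬ IsZeroVec F u

  _*ᵥ_ : ∀ {k} → Carrier → Vec k → Vec k
  (c *ᵥ v) t = c * v t

  _-ᵥ_ : ∀ {k} → Vec k → Vec k → Vec k
  (u -ᵥ v) t = u t - v t

  infixl 7 _*ᵥ_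
  infixl 6 _-ᵥ_

  ⟨_,_⟩ : ∀ {k} → Vec k → Vec k → Carrier
  ⟨_,_⟩ = Defs.⟨_,_⟩ F

  ⟨⟩≡sum : ∀ {k} (u v : Vec k) → ⟨ u , v ⟩ ≡ ΣF.sum (λ t → u t * v t)
  ⟨⟩≡sum {zero}  u v = refl
  ⟨⟩≡sum {suc k} u v = cong (u zero * v zero +_) (⟨⟩≡sum (tail u) (tail v))

  ⟨⟩-cong : ∀ {k} {u u′ v v′ : Vec k} → (∀ t → u t ≡ u′ t) → (∀ t → v t ≡ v′ t) →
            ⟨ u , v ⟩ ≡ ⟨ u′ , v′ ⟩
  ⟨⟩-cong {zero}  u≗u′ v≗v′ = refl
  ⟨⟩-cong {suc k} u≗u′ v≗v′ =
    cong₂ _+_ (cong₂ _*_ (u≗u′ zero) (v≗v′ zero)) (⟨⟩-cong (u≗u′ ∘ suc) (v≗v′ ∘ suc))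

  ⟨⟩-comm : ∀ {k} (u v : Vec k) → ⟨ u , v ⟩ ≡ ⟨ v , u ⟩
  ⟨⟩-comm {zero}  u v = refl
  ⟨⟩-comm {suc k} u v = cong₂ _+_ (*-comm (u zero) (v zero)) (⟨⟩-comm (tail u) (tail v))

  ⟨⟩-scaleʳ : ∀ {k} (u : Vec k) (c : Carrier) (v : Vec k) → ⟨ u , c *ᵥ v ⟩ ≡ c * ⟨ u , v ⟩
  ⟨⟩-scaleʳ u c v = begin
    ⟨ u , c *ᵥ v ⟩                  ≡⟨ ⟨⟩≡sum u (c *ᵥ v) ⟩
    ΣF.sum (λ t → u t * (c * v t))
      ≡⟨ ΣF.sum-cong-≗ (λ t → solve 3 (λ u c v → u :* (c :* v) := c :* (u :* v)) refl (u t) c (v t)) ⟩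
    ΣF.sum (λ t → c * (u t * v t))  ≡⟨ ΣF.*-distribˡ-sum c (λ t → u t * v t) ⟨
    c * ΣF.sum (λ t → u t * v t)    ≡⟨ cong (c *_) (⟨⟩≡sum u v) ⟨
    c * ⟨ u , v ⟩                   ∎
    where open ≡-Reasoning

  ⟨⟩-subʳ : ∀ {k} (u v w : Vec k) → ⟨ u , v -ᵥ w ⟩ ≡ ⟨ u , v ⟩ - ⟨ u , w ⟩
  ⟨⟩-subʳ u v w = begin
    ⟨ u , v -ᵥ w ⟩                                           ≡⟨ ⟨⟩≡sum u (v -ᵥ w) ⟩
    ΣF.sum (λ t → u t * (v t - w t))                         ≡⟨ ΣF.sum-cong-≗ pointwise ⟩
    ΣF.sum (λ t → u t * v t + - 1# * (u t * w t))
                                                             ≡⟨ ΣF.∑-distrib-+ (λ t → u t * v t) (λ t → - 1# * (u t * w t)) ⟩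
    ΣF.sum (λ t → u t * v t) + ΣF.sum (λ t → - 1# * (u t * w t))
                                                             ≡⟨ cong (_ +_) (ΣF.*-distribˡ-sum (- 1#) (λ t → u t * w t)) ⟨
    ΣF.sum (λ t → u t * v t) + - 1# * ΣF.sum (λ t → u t * w t)
                                                  ≡⟨ cong₂ (λ x y → x + - 1# * y) (⟨⟩≡sum u v) (⟨⟩≡sum u w) ⟨
    ⟨ u , v ⟩ + - 1# * ⟨ u , w ⟩                             ≡⟨ cong (⟨ u , v ⟩ +_) (-1*x≈-x _) ⟩
    ⟨ u , v ⟩ - ⟨ u , w ⟩                                    ∎
    where
    open ≡-Reasoning
    pointwise : ∀ t → u t * (v t - w t) ≡ u t * v t + - 1# * (u t * w t)
    pointwise t = trans (x[y-z]≈xy-xz (u t) (v t) (w t)) (cong (u t * v t +_) (sym (-1*x≈-x _)))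

  ⟨⟩-zeroʳ : ∀ {k} (u v : Vec k) → IsZeroVec F v → ⟨ u , v ⟩ ≡ 0#
  ⟨⟩-zeroʳ {zero}  u v v≡0 = refl
  ⟨⟩-zeroʳ {suc k} u v v≡0 = begin
    u zero * v zero + ⟨ tail u , tail v ⟩
      ≡⟨ cong₂ _+_ (cong (u zero *_) (v≡0 zero)) (⟨⟩-zeroʳ (tail u) (tail v) (v≡0 ∘ suc)) ⟩
    u zero * 0# + 0#                       ≡⟨ solve 1 (λ x → x :* con 0 :+ con 0 := con 0) refl (u zero) ⟩
    0#                                     ∎
    where open ≡-Reasoning

  ⟨⟩-remove : ∀ {k} (t : Fin (suc k)) (u v : Vec (suc k)) →
              ⟨ u , v ⟩ ≡ u t * v t + ⟨ u ∘ punchIn t , v ∘ punchIn t ⟩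
  ⟨⟩-remove t u v = begin
    ⟨ u , v ⟩                                            ≡⟨ ⟨⟩≡sum u v ⟩
    ΣF.sum (λ s → u s * v s)                             ≡⟨ ΣF.sum-remove {i = t} (λ s → u s * v s) ⟩
    u t * v t + ΣF.sum (λ s → u (punchIn t s) * v (punchIn t s))
                                                         ≡⟨ cong (u t * v t +_) (⟨⟩≡sum (u ∘ punchIn t) (v ∘ punchIn t)) ⟨
    u t * v t + ⟨ u ∘ punchIn t , v ∘ punchIn t ⟩        ∎
    where open ≡-Reasoning

  ⟨⟩-scaleˡ : ∀ {k} (c : Carrier) (u v : Vec k) → ⟨ c *ᵥ u , v ⟩ ≡ c * ⟨ u , v ⟩
  ⟨⟩-scaleˡ c u v = trans (⟨⟩-comm (c *ᵥ u) v) (trans (⟨⟩-scaleʳ v c u) (cong (c *_) (⟨⟩-comm v u)))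

  ⟨⟩-subˡ : ∀ {k} (u w v : Vec k) → ⟨ u -ᵥ w , v ⟩ ≡ ⟨ u , v ⟩ - ⟨ w , v ⟩
  ⟨⟩-subˡ u w v = trans (⟨⟩-comm (u -ᵥ w) v) (trans (⟨⟩-subʳ v u w) (cong₂ _-_ (⟨⟩-comm v u) (⟨⟩-comm v w)))

  ⟨⟩-zeroˡ : ∀ {k} (u v : Vec k) → IsZeroVec F u → ⟨ u , v ⟩ ≡ 0#
  ⟨⟩-zeroˡ u v u≡0 = trans (⟨⟩-comm u v) (⟨⟩-zeroʳ v u u≡0)

  unit : ∀ {k} → Fin (suc k) → Vec (suc k)
  unit t = insertAt (λ _ → 0#) t 1#

  ⟨⟩-unitʳ : ∀ {k} (u : Vec (suc k)) (t : Fin (suc k)) → ⟨ u , unit t ⟩ ≡ u t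
  ⟨⟩-unitʳ u t = begin
    ⟨ u , unit t ⟩                                       ≡⟨ ⟨⟩-remove t u (unit t) ⟩
    u t * unit t t + ⟨ u ∘ punchIn t , unit t ∘ punchIn t ⟩
      ≡⟨ cong₂ _+_ (cong (u t *_) (insertAt-lookup _ t 1#))
                   (⟨⟩-zeroʳ (u ∘ punchIn t) _ (insertAt-punchIn _ t 1#)) ⟩
    u t * 1# + 0#                                        ≡⟨ solve 1 (λ x → x :* con 1 :+ con 0 := x) refl (u t) ⟩
    u t                                                  ∎
    where open ≡-Reasoning

  unit-nonzero : ∀ {k} (t : Fin (suc k)) → Nonzero (unit t)
  unit-nonzero t unit≡0 = 0≢1 (trans (sym (unit≡0 t)) (insertAt-lookup _ t 1#))

  nonzero-coordinate : ∀ {k} {u : Vec k} → Nonzero u → ∃ λ t → u t ≢ 0#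
  nonzero-coordinate {k} {u} = Finₚ.¬∀⟶∃¬ k (λ t → u t ≡ 0#) (λ t → u t ≟ 0#)

  ⟨⟩≢0⇒nonzeroˡ : ∀ {k} {u v : Vec k} → ⟨ u , v ⟩ ≢ 0# → Nonzero u
  ⟨⟩≢0⇒nonzeroˡ {u = u} {v} uv≢0 u≡0 = uv≢0 (⟨⟩-zeroˡ u v u≡0)

  hyperplane-through : ∀ {m k} → m < k → (w : Fin m → Vec k) →
                       Σ[ u ∈ Vec k ] Nonzero u × (∀ x → ⟨ u , w x ⟩ ≡ 0#)
  hyperplane-through {zero}  {suc k} _ w = unit zero , unit-nonzero zero , λ ()
  hyperplane-through {suc m} {suc k} (s≤s m<k) w with Finₚ.any? (λ x → ¬? (w x zero ≟ 0#))
  ... | no no-pivot = unit zero , unit-nonzero zero , λ x →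
    trans (⟨⟩-comm (unit zero) (w x))
          (trans (⟨⟩-unitʳ (w x) zero) (decidable-stable (w x zero ≟ 0#) (λ wx≢0 → no-pivot (x , wx≢0))))
  ... | yes (x₀ , a≢0) = u , u-nonzero , u⊥w
    where
    a = w x₀ zero
    -- eliminate the first coordinate of every w x against the pivot w x₀
    reduced : Fin m → Vec k
    reduced y = a *ᵥ tail (w (punchIn x₀ y)) -ᵥ w (punchIn x₀ y) zero *ᵥ tail (w x₀)
    u′ = proj₁ (hyperplane-through m<k reduced)
    S = ⟨ u′ , tail (w x₀) ⟩
    u = - S ∷ a *ᵥ u′
    u-nonzero : Nonzero u
    u-nonzero u≡0 = proj₁ (proj₂ (hyperplane-through m<k reduced)) (λ t → *-cancelˡ-0 _ a≢0 (u≡0 (suc t)))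
    ⟨u,_⟩ : ∀ v → ⟨ u , v ⟩ ≡ a * ⟨ u′ , tail v ⟩ - S * v zero
    ⟨u, v ⟩ = begin
      - S * v zero + ⟨ a *ᵥ u′ , tail v ⟩
        ≡⟨ cong₂ _+_ (sym (-‿distribˡ-* S (v zero))) (⟨⟩-scaleˡ a u′ (tail v)) ⟩
      - (S * v zero) + a * ⟨ u′ , tail v ⟩  ≡⟨ +-comm _ _ ⟩
      a * ⟨ u′ , tail v ⟩ - S * v zero      ∎
      where open ≡-Reasoning
    u⊥others : ∀ y → ⟨ u , w (punchIn x₀ y) ⟩ ≡ 0#
    u⊥others y = trans ⟨u, w (punchIn x₀ y) ⟩ (x≈y⇒x∙y⁻¹≈ε (trans aT≡bS (*-comm _ S)))
      where
      aT≡bS = x∙y⁻¹≈ε⇒x≈y _ _ (begin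
        a * ⟨ u′ , tail (w (punchIn x₀ y)) ⟩ - w (punchIn x₀ y) zero * S
          ≡⟨ cong₂ _-_ (⟨⟩-scaleʳ u′ a _) (⟨⟩-scaleʳ u′ _ (tail (w x₀))) ⟨
        ⟨ u′ , a *ᵥ tail (w (punchIn x₀ y)) ⟩ - ⟨ u′ , w (punchIn x₀ y) zero *ᵥ tail (w x₀) ⟩
          ≡⟨ ⟨⟩-subʳ u′ _ _ ⟨
        ⟨ u′ , reduced y ⟩
          ≡⟨ proj₂ (proj₂ (hyperplane-through m<k reduced)) y ⟩
        0# ∎)
        where open ≡-Reasoning
    u⊥w : ∀ x → ⟨ u , w x ⟩ ≡ 0#
    u⊥w x with x₀ Finₚ.≟ x
    ... | yes refl = trans ⟨u, w x₀ ⟩ (x≈y⇒x∙y⁻¹≈ε (*-comm a S))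
    ... | no x₀≢x  = subst (λ x → ⟨ u , w x ⟩ ≡ 0#) (Finₚ.punchIn-punchOut x₀≢x) (u⊥others (punchOut x₀≢x))

  index : Carrier → Fin q
  index = Inverse.to enumeration

  element : Fin q → Carrier
  element = Inverse.from enumeration

  element-index : ∀ x → element (index x) ≡ x
  element-index x = Inverse.inverseʳ enumeration refl

  index-injective : ∀ {x y} → index x ≡ index y → x ≡ y
  index-injective {x} {y} eq = trans (sym (element-index x)) (trans (cong element eq) (element-index y))

  pigeonhole-nonzero : ∀ {K} → q ≤ K → (r : Fin K → Carrier) → (∀ m → r m ≢ 0#) →
                       ∃₂ λ m l → m ≢ l × r m ≡ r l
  pigeonhole-nonzero {K} q≤K r r≢0 = distinct (Finₚ.pigeonhole (s≤s q≤K) φ)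
    where
    -- 0# is adjoined so that K + 1 > q values are compared
    φ : Fin (suc K) → Fin q
    φ zero    = index 0#
    φ (suc m) = index (r m)
    distinct : (∃₂ λ x y → x Data.Fin.< y × φ x ≡ φ y) → ∃₂ λ m l → m ≢ l × r m ≡ r l
    distinct (zero  , suc l , _          , φ≡) = ⊥-elim (r≢0 l (sym (index-injective φ≡)))
    distinct (suc m , suc l , s≤s m<l , φ≡) = m , l , Finₚ.<⇒≢ m<l , index-injective φ≡

  2≤q : 2 ≤ q
  2≤q = Finₚ.injective⇒≤ {f = two} two-injective
    where
    two : Fin 2 → Fin q
    two zero       = index 0#
    two (suc zero) = index 1#
    two-injective : Injective _≡_ _≡_ two
    two-injective {zero}     {zero}     _  = refl
    two-injective {zero}     {suc zero} eq = ⊥-elim (0≢1 (index-injective eq))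
    two-injective {suc zero} {zero}     eq = ⊥-elim (0≢1 (index-injective (sym eq)))
    two-injective {suc zero} {suc zero} _  = refl

  any?-Vec : ∀ {k} (Q : Vec k → Set) → (∀ {u v} → (∀ t → u t ≡ v t) → Q u → Q v) →
             (∀ u → Dec (Q u)) → Dec (∃ Q)
  any?-Vec {zero} Q resp Q? with Q? (λ ())
  ... | yes Q[] = yes (_ , Q[])
  ... | no ¬Q[] = no λ (u , Qu) → ¬Q[] (resp (λ ()) Qu)
  any?-Vec {suc k} Q resp Q?
    with Finₚ.any? (λ a → any?-Vec (λ w → Q (element a ∷ w)) (resp ∘ ∷-cong) (Q? ∘ (element a ∷_)))
    where
    ∷-cong : ∀ {x} {u v : Vec k} → (∀ t → u t ≡ v t) → ∀ t → (x ∷ u) t ≡ (x ∷ v) t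
    ∷-cong u≗v zero    = refl
    ∷-cong u≗v (suc t) = u≗v t
  ... | yes (a , w , Qw) = yes (element a ∷ w , Qw)
  ... | no none = no λ (u , Qu) → none (index (u zero) , tail u , resp (η u) Qu)
    where
    η : ∀ u t → u t ≡ (element (index (u zero)) ∷ tail u) t
    η u zero    = sym (element-index (u zero))
    η u (suc t) = refl

  -- Hyperplane counts of projective systems

  isZero : Carrier → Bool
  isZero x = does (x ≟ 0#)

  onHyperplane : ∀ {k} → Vec k → Vec k → Bool
  onHyperplane u v = isZero ⟨ u , v ⟩

  onHyperplane⁺ : ∀ {k} (u v : Vec k) → ⟨ u , v ⟩ ≡ 0# → onHyperplane u v ≡ true
  onHyperplane⁺ u v = dec-true (⟨ u , v ⟩ ≟ 0#)

  onHyperplane⁻ : ∀ {k} (u v : Vec k) → onHyperplane u v ≡ true → ⟨ u , v ⟩ ≡ 0#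
  onHyperplane⁻ u v on with ⟨ u , v ⟩ ≟ 0#
  ... | yes uv≡0 = uv≡0

  pointsOn : ∀ {n k} → PointFamily F n k → Vec k → ℕ
  pointsOn G u = countTrue (λ j → onHyperplane u (G j))

  count≡countTrue : ∀ n {P : Fin n → Set} (P? : ∀ j → Dec (P j)) → count F n P? ≡ countTrue (does ∘ P?)
  count≡countTrue zero    P? = refl
  count≡countTrue (suc n) P? with P? zero
  ... | yes _ = cong suc (count≡countTrue n (P? ∘ suc))
  ... | no  _ = count≡countTrue n (P? ∘ suc)

  hyperplaneCount≡pointsOn : ∀ {n k} (G : PointFamily F n k) u → hyperplaneCount F G u ≡ pointsOn G u
  hyperplaneCount≡pointsOn {n} G u = count≡countTrue n (λ j → ⟨ u , G j ⟩ ≟ 0#)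

  pointsOn-cong : ∀ {n k} (G : PointFamily F n k) {u v : Vec k} → (∀ t → u t ≡ v t) → pointsOn G u ≡ pointsOn G v
  pointsOn-cong G {u} {v} u≗v =
    countTrue-cong (λ l → cong isZero (⟨⟩-cong {u = u} {u′ = v} {v = G l} {v′ = G l} u≗v (λ _ → refl)))

  module AsMDSCode (s : ℕ) {n k d : ℕ} {G : PointFamily F n k} (sys : IsProjSystem F n k d G) (mds : IsAsMDS F s n k d) where

    private
      hasMinDist = proj₂ (proj₂ sys)

      pointsOn+d≤n : ∀ u → Nonzero u → pointsOn G u ℕ.+ d ≤ n
      pointsOn+d≤n u u≢0 =
        subst (λ c → c ℕ.+ d ≤ n) (hyperplaneCount≡pointsOn G u) (proj₂ hasMinDist u u≢0)

    pointsOn<s+k : ∀ u → Nonzero u → pointsOn G u < s ℕ.+ k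
    pointsOn<s+k u u≢0 = ℕₚ.+-cancelʳ-≤ d _ _
      (subst (suc (pointsOn G u ℕ.+ d) ≤_) (trans (ℕₚ.+-comm 1 n) mds) (s≤s (pointsOn+d≤n u u≢0)))

    private
      u₀ = proj₁ (proj₁ hasMinDist)
      u₀≢0 = proj₁ (proj₂ (proj₁ hasMinDist))
      pointsOn-u₀+d≡n : pointsOn G u₀ ℕ.+ d ≡ n
      pointsOn-u₀+d≡n = subst (λ c → c ℕ.+ d ≡ n) (hyperplaneCount≡pointsOn G u₀) (proj₂ (proj₂ (proj₁ hasMinDist)))

    fullest-hyperplane : Σ[ u ∈ Vec k ] Nonzero u × suc (pointsOn G u) ≡ s ℕ.+ k
    fullest-hyperplane =
      u₀ , u₀≢0 , ℕₚ.+-cancelʳ-≡ d _ _ (trans (cong suc pointsOn-u₀+d≡n) (trans (ℕₚ.+-comm 1 n) mds))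

    dimension≤length : k ≤ n
    dimension≤length = ℕₚ.+-cancelʳ-≤ 1 k n (begin
      k ℕ.+ 1          ≤⟨ ℕₚ.+-monoʳ-≤ k 1≤d ⟩
      k ℕ.+ d          ≤⟨ ℕₚ.+-monoˡ-≤ d (ℕₚ.m≤n+m k s) ⟩
      s ℕ.+ k ℕ.+ d    ≡⟨ mds ⟨
      n ℕ.+ 1          ∎)
      where
      open ℕₚ.≤-Reasoning
      off = proj₁ (proj₂ sys) u₀ u₀≢0
      1≤d : 1 ≤ d
      1≤d = ℕₚ.+-cancelˡ-≤ (pointsOn G u₀) 1 d (begin
        pointsOn G u₀ ℕ.+ 1  ≡⟨ ℕₚ.+-comm _ 1 ⟩
        suc (pointsOn G u₀)  ≤⟨ countTrue<n _ (proj₁ off) (dec-false (⟨ u₀ , G (proj₁ off) ⟩ ≟ 0#) (proj₂ off)) ⟩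
        n                    ≡⟨ pointsOn-u₀+d≡n ⟨
        pointsOn G u₀ ℕ.+ d  ∎)

  module RepeatedPoint {n k : ℕ} (G : PointFamily F (suc (suc n)) k) {i j : Fin (suc (suc n))}
                       (i≢j : i ≢ j) (same : SamePoint F (G i) (G j)) where

    open Others i≢j public

    ⊥-repeated : ∀ u → ⟨ u , G i ⟩ ≡ 0# → ⟨ u , G j ⟩ ≡ 0#
    ⊥-repeated u u⊥Gi = *-cancelˡ-0 _ (proj₁ (proj₂ same)) (begin
      λ′ * ⟨ u , G j ⟩     ≡⟨ ⟨⟩-scaleʳ u λ′ (G j) ⟨
      ⟨ u , λ′ *ᵥ G j ⟩    ≡⟨ ⟨⟩-cong (λ _ → refl) (sym ∘ proj₂ (proj₂ same)) ⟩
      ⟨ u , G i ⟩          ≡⟨ u⊥Gi ⟩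
      0#                   ∎)
      where
      open ≡-Reasoning
      λ′ = proj₁ same

    pointsOn-through-≥ : ∀ {c} u (g : Fin c → Fin n) → Injective _≡_ _≡_ g → ⟨ u , G i ⟩ ≡ 0# →
                         2 ℕ.+ countTrue (λ x → onHyperplane u (G (others (g x)))) ≤ pointsOn G u
    pointsOn-through-≥ u g g-inj u⊥Gi = 2+countTrue-others≤ (λ l → onHyperplane u (G l))
      (onHyperplane⁺ u (G i) u⊥Gi) (onHyperplane⁺ u (G j) (⊥-repeated u u⊥Gi)) g g-inj

  projective-if-no-repeats : ∀ {n k} {G : PointFamily F n k} →
                             (∀ {i j} → i ≢ j → ¬ SamePoint F (G i) (G j)) → Projective F G
  projective-if-no-repeats no-repeats i j same with i Finₚ.≟ j
  ... | yes i≡j = i≡j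
  ... | no  i≢j = ⊥-elim (no-repeats i≢j same)

  MDS⇒projective : ∀ {s n k d} {G : PointFamily F (suc (suc n)) (suc (suc k))} →
                   IsProjSystem F _ _ d G → IsAsMDS F s (suc (suc n)) (suc (suc k)) d → s ≡ 0 → Projective F G
  MDS⇒projective {n = n} {k} {G = G} sys mds refl = projective-if-no-repeats λ {i} {j} i≢j same →
    let open AsMDSCode 0 sys mds
        open RepeatedPoint G i≢j same
        k≤n = ℕₚ.≤-pred (ℕₚ.≤-pred dimension≤length)
        w : Fin (suc k) → Vec (suc (suc k))
        w = G i ∷ λ x → G (others (inject≤ x k≤n))
        u , u≢0 , u⊥w = hyperplane-through ℕₚ.≤-refl w
    in ℕₚ.<⇒≱ (pointsOn<s+k u u≢0)
         (2+c≤countTrue (λ l → onHyperplane u (G l))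
                        (onHyperplane⁺ u (G i) (u⊥w zero)) (onHyperplane⁺ u (G j) (⊥-repeated u (u⊥w zero)))
                        k≤n (λ x → onHyperplane⁺ u (G (others (inject≤ x k≤n))) (u⊥w (suc x))))

  -- The projective line

  ∀-Fin2 : (t : Fin 2) (P : Fin 2 → Set) → P t → P (punchIn t zero) → ∀ x → P x
  ∀-Fin2 zero       P Pt Pt′ zero       = Pt
  ∀-Fin2 zero       P Pt Pt′ (suc zero) = Pt′
  ∀-Fin2 (suc zero) P Pt Pt′ zero       = Pt′
  ∀-Fin2 (suc zero) P Pt Pt′ (suc zero) = Pt

  ⟨⟩-Fin2 : (t : Fin 2) (u v : Vec 2) → ⟨ u , v ⟩ ≡ u t * v t + u (punchIn t zero) * v (punchIn t zero)
  ⟨⟩-Fin2 t u v = trans (⟨⟩-remove t u v) (cong (u t * v t +_) (+-identityʳ _))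

  ⊥-common-vector⇒SamePoint : (u v w : Vec 2) → Nonzero u → Nonzero v → Nonzero w →
                              ⟨ u , v ⟩ ≡ 0# → ⟨ u , w ⟩ ≡ 0# → SamePoint F v w
  ⊥-common-vector⇒SamePoint u v w u≢0 v≢0 w≢0 u⊥v u⊥w = λ′ , λ′≢0 , v≡λ′w
    where
    open ≡-Reasoning
    t = proj₁ (nonzero-coordinate w≢0)
    wt≢0 = proj₂ (nonzero-coordinate w≢0)
    t′ = punchIn t zero
    λ′ = v t * inv (w t) wt≢0
    z = v -ᵥ λ′ *ᵥ w

    u⊥z : ⟨ u , z ⟩ ≡ 0#
    u⊥z = begin
      ⟨ u , z ⟩                          ≡⟨ ⟨⟩-subʳ u v (λ′ *ᵥ w) ⟩
      ⟨ u , v ⟩ - ⟨ u , λ′ *ᵥ w ⟩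
        ≡⟨ cong₂ _-_ u⊥v (trans (⟨⟩-scaleʳ u λ′ w) (cong (λ′ *_) u⊥w)) ⟩
      0# - λ′ * 0#                       ≡⟨ cong (λ x → 0# - x) (zeroʳ λ′) ⟩
      0# - 0#                            ≡⟨ -‿inverseʳ 0# ⟩
      0#                                 ∎

    zt≡0 : z t ≡ 0#
    zt≡0 = x≈y⇒x∙y⁻¹≈ε (sym (x*y⁻¹*y≡x (v t) wt≢0))

    ut′≢0 : u t′ ≢ 0#
    ut′≢0 ut′≡0 = *-nonzero ut≢0 wt≢0 (begin
      u t * w t                          ≡⟨ solve 2 (λ a b → a := a :+ con 0 :* b) refl (u t * w t) (w t′) ⟩
      u t * w t + 0# * w t′              ≡⟨ cong (λ x → u t * w t + x * w t′) ut′≡0 ⟨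
      u t * w t + u t′ * w t′            ≡⟨ ⟨⟩-Fin2 t u w ⟨
      ⟨ u , w ⟩                          ≡⟨ u⊥w ⟩
      0#                                 ∎)
      where
      ut≢0 : u t ≢ 0#
      ut≢0 ut≡0 = u≢0 (∀-Fin2 t (λ x → u x ≡ 0#) ut≡0 ut′≡0)

    zt′≡0 : z t′ ≡ 0#
    zt′≡0 = *-cancelˡ-0 (z t′) ut′≢0 (begin
      u t′ * z t′                        ≡⟨ solve 2 (λ a b → a := b :* con 0 :+ a) refl (u t′ * z t′) (u t) ⟩
      u t * 0# + u t′ * z t′             ≡⟨ cong (λ x → u t * x + u t′ * z t′) zt≡0 ⟨
      u t * z t + u t′ * z t′            ≡⟨ ⟨⟩-Fin2 t u z ⟨
      ⟨ u , z ⟩                          ≡⟨ u⊥z ⟩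
      0#                                 ∎)

    v≡λ′w : ∀ x → v x ≡ λ′ * w x
    v≡λ′w x = x∙y⁻¹≈ε⇒x≈y _ _ (∀-Fin2 t (λ x → z x ≡ 0#) zt≡0 zt′≡0 x)

    λ′≢0 : λ′ ≢ 0#
    λ′≢0 λ′≡0 = v≢0 λ x → trans (v≡λ′w x) (trans (cong (_* w x) λ′≡0) (zeroˡ (w x)))

  projective-line⇒MDS : ∀ {s n d} {G : PointFamily F n 2} →
                        IsProjSystem F n 2 d G → IsAsMDS F s n 2 d → Projective F G → s ≡ 0
  projective-line⇒MDS {zero}              sys mds projective = refl
  projective-line⇒MDS {suc s} {G = G} sys mds projective =
    ⊥-elim (i≢j (projective i j (⊥-common-vector⇒SamePoint u (G i) (G j) u≢0 (proj₁ sys i) (proj₁ sys j)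
                                   (onHyperplane⁻ u (G i) on-i) (onHyperplane⁻ u (G j) on-j))))
    where
    open AsMDSCode (suc s) sys mds
    u = proj₁ fullest-hyperplane
    u≢0 = proj₁ (proj₂ fullest-hyperplane)
    1<pointsOn : 1 < pointsOn G u
    1<pointsOn = subst (2 ≤_) (sym (ℕₚ.suc-injective (proj₂ (proj₂ fullest-hyperplane)))) (ℕₚ.m≤n+m 2 s)
    witnesses = countTrue-witness₂ _ 1<pointsOn
    i = proj₁ witnesses
    j = proj₁ (proj₂ witnesses)
    i≢j = proj₁ (proj₂ (proj₂ witnesses))
    on-i = proj₁ (proj₂ (proj₂ (proj₂ witnesses)))
    on-j = proj₂ (proj₂ (proj₂ (proj₂ witnesses)))

  projective-line⇔MDS : ∀ {s n k d} {G : PointFamily F (suc (suc n)) k} →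
                        IsProjSystem F _ k d G → IsAsMDS F s (suc (suc n)) k d → k ≡ 2 → (Projective F G ⇔ s ≡ 0)
  projective-line⇔MDS sys mds refl = mk⇔ (projective-line⇒MDS sys mds) (MDS⇒projective sys mds)

  -- Pencils of hyperplanes

  -- a point lies on exactly one of the q + 1 hyperplanes A - c B = 0 and B = 0, or on all of them
  pencil-incidence : (A B : Carrier) →
    1 ℕ.+ q ℕ.* 𝟙 (isZero A ∧ isZero B) ≤ countTrue (λ a → isZero (A - element a * B)) ℕ.+ 𝟙 (isZero B)
  pencil-incidence A B with B ≟ 0#
  ... | no B≢0 = begin
    1 ℕ.+ q ℕ.* 𝟙 (isZero A ∧ false)  ≡⟨ cong (λ b → 1 ℕ.+ q ℕ.* 𝟙 b) (∧-zeroʳ (isZero A)) ⟩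
    1 ℕ.+ q ℕ.* 0                      ≡⟨ cong suc (ℕₚ.*-zeroʳ q) ⟩
    1                                  ≤⟨ countTrue-pos _ (index c) (dec-true (_ ≟ 0#) on-c) ⟩
    hits                               ≤⟨ ℕₚ.m≤m+n hits 0 ⟩
    hits ℕ.+ 0                         ∎
    where
    open ℕₚ.≤-Reasoning
    hits = countTrue (λ a → isZero (A - element a * B))
    c = A * inv B B≢0
    on-c : A - element (index c) * B ≡ 0#
    on-c = x≈y⇒x∙y⁻¹≈ε (sym (trans (cong (_* B) (element-index c)) (x*y⁻¹*y≡x A B≢0)))
  ... | yes B≡0 with A ≟ 0#
  ...   | no _    = subst (_≤ countTrue (λ a → isZero (A - element a * B)) ℕ.+ 1)
                          (cong suc (sym (ℕₚ.*-zeroʳ q))) (ℕₚ.m≤n+m 1 _)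
  ...   | yes A≡0 = ℕₚ.≤-reflexive (begin
    1 ℕ.+ q ℕ.* 1                                          ≡⟨ ℕₚ.+-comm 1 _ ⟩
    q ℕ.* 1 ℕ.+ 1                                          ≡⟨ cong (ℕ._+ 1) (ℕₚ.*-identityʳ q) ⟩
    q ℕ.+ 1                                                ≡⟨ cong (ℕ._+ 1) (countTrue-all _ every-a) ⟨
    countTrue (λ a → isZero (A - element a * B)) ℕ.+ 1     ∎)
    where
    open ≡-Reasoning
    every-a : ∀ a → isZero (A - element a * B) ≡ true
    every-a a = dec-true (_ ≟ 0#) (x≈y⇒x∙y⁻¹≈ε (trans A≡0 (sym (trans (cong (element a *_) B≡0) (zeroʳ _)))))

  pencil-count : ∀ {n k} (G : PointFamily F n k) (u₁ u₂ : Vec k) →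
    n ℕ.+ q ℕ.* countTrue (λ l → onHyperplane u₁ (G l) ∧ onHyperplane u₂ (G l))
      ≤ sum (λ a → pointsOn G (u₁ -ᵥ element a *ᵥ u₂)) ℕ.+ pointsOn G u₂
  pencil-count {n} G u₁ u₂ = begin
    n ℕ.+ q ℕ.* countTrue axis
      ≡⟨ cong₂ ℕ._+_ (sym (countTrue-all {n} (λ _ → true) (λ _ → refl))) (*-distribˡ-sum q (𝟙 ∘ axis)) ⟩
    sum {n} (λ _ → 1) ℕ.+ sum (λ l → q ℕ.* 𝟙 (axis l))
      ≡⟨ ∑-distrib-+ {n} (λ _ → 1) (λ l → q ℕ.* 𝟙 (axis l)) ⟨
    sum (λ l → 1 ℕ.+ q ℕ.* 𝟙 (axis l))
      ≤⟨ sum-mono-≤ incidence ⟩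
    sum (λ l → countTrue (λ a → onHyperplane (H a) (G l)) ℕ.+ 𝟙 (onHyperplane u₂ (G l)))
      ≡⟨ ∑-distrib-+ (λ l → countTrue (λ a → onHyperplane (H a) (G l))) (λ l → 𝟙 (onHyperplane u₂ (G l))) ⟩
    sum (λ l → countTrue (λ a → onHyperplane (H a) (G l))) ℕ.+ pointsOn G u₂
      ≡⟨ cong (ℕ._+ pointsOn G u₂) (∑-comm (λ l a → 𝟙 (onHyperplane (H a) (G l)))) ⟩
    sum (λ a → pointsOn G (H a)) ℕ.+ pointsOn G u₂  ∎
    where
    open ℕₚ.≤-Reasoning
    axis : Fin n → Bool
    axis l = onHyperplane u₁ (G l) ∧ onHyperplane u₂ (G l)
    H : Fin q → Vec _
    H a = u₁ -ᵥ element a *ᵥ u₂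
    ⟨H,_⟩ : ∀ v a → ⟨ H a , v ⟩ ≡ ⟨ u₁ , v ⟩ - element a * ⟨ u₂ , v ⟩
    ⟨H, v ⟩ a = trans (⟨⟩-subˡ u₁ (element a *ᵥ u₂) v)
                      (cong (λ x → ⟨ u₁ , v ⟩ - x) (⟨⟩-scaleˡ (element a) u₂ v))
    incidence : ∀ l → 1 ℕ.+ q ℕ.* 𝟙 (axis l) ≤
                      countTrue (λ a → onHyperplane (H a) (G l)) ℕ.+ 𝟙 (onHyperplane u₂ (G l))
    incidence l = subst (λ c → 1 ℕ.+ q ℕ.* 𝟙 (axis l) ≤ c ℕ.+ 𝟙 (onHyperplane u₂ (G l)))
                        (countTrue-cong (λ a → cong isZero (sym (⟨H, G l ⟩ a))))
                        (pencil-incidence ⟨ u₁ , G l ⟩ ⟨ u₂ , G l ⟩)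

  pencil-through : ∀ {m k} → suc m < suc k → (w : Fin m → Vec (suc k)) →
    Σ[ u₁ ∈ Vec (suc k) ] Σ[ u₂ ∈ Vec (suc k) ]
      (∀ x → ⟨ u₁ , w x ⟩ ≡ 0# × ⟨ u₂ , w x ⟩ ≡ 0#) × Nonzero u₂ × (∀ c → Nonzero (u₁ -ᵥ c *ᵥ u₂))
  pencil-through m+1<k w = u₁ , u₂ , (λ x → u₁⊥w x , u₂⊥ (suc x)) , u₂≢0 , member≢0
    where
    first = hyperplane-through (ℕₚ.<⇒≤ m+1<k) w
    u₁ = proj₁ first
    u₁⊥w = proj₂ (proj₂ first)
    t = proj₁ (nonzero-coordinate (proj₁ (proj₂ first)))
    u₁t≢0 = proj₂ (nonzero-coordinate (proj₁ (proj₂ first)))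
    -- u₂ vanishes at the coordinate t where u₁ does not, so no member u₁ - c u₂ of the pencil is zero
    second = hyperplane-through m+1<k (unit t ∷ w)
    u₂ = proj₁ second
    u₂≢0 = proj₁ (proj₂ second)
    u₂⊥ = proj₂ (proj₂ second)
    member≢0 : ∀ c → Nonzero (u₁ -ᵥ c *ᵥ u₂)
    member≢0 c member≡0 = u₁t≢0 (begin
      u₁ t       ≡⟨ x∙y⁻¹≈ε⇒x≈y _ _ (member≡0 t) ⟩
      c * u₂ t   ≡⟨ cong (c *_) (trans (sym (⟨⟩-unitʳ u₂ t)) (u₂⊥ zero)) ⟩
      c * 0#     ≡⟨ zeroʳ c ⟩
      0#         ∎)
      where open ≡-Reasoning

  repeated-point⇒short : ∀ {s n k d} {G : PointFamily F (suc (suc n)) (suc (suc (suc k)))} →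
                         IsProjSystem F _ _ d G → IsAsMDS F s (suc (suc n)) (suc (suc (suc k))) d →
                         ∀ {i j} → i ≢ j → SamePoint F (G i) (G j) → suc (suc n) ≤ s ℕ.* (q ℕ.+ 1) ℕ.+ suc (suc k)
  repeated-point⇒short {s} {n} {k} {G = G} sys mds {i} {j} i≢j same = pencil-bound _ q s (suc (suc k)) (begin
    suc (suc n) ℕ.+ q ℕ.* suc (suc k)    ≤⟨ ℕₚ.+-monoʳ-≤ (suc (suc n)) (ℕₚ.*-monoʳ-≤ q axis-count) ⟩
    suc (suc n) ℕ.+ q ℕ.* countTrue axis  ≤⟨ pencil-count G u₁ u₂ ⟩
    sum (λ a → pointsOn G (u₁ -ᵥ element a *ᵥ u₂)) ℕ.+ pointsOn G u₂
      ≤⟨ ℕₚ.+-mono-≤ (sum-mono-≤ (λ a → bound (member≢0 (element a)))) (bound u₂≢0) ⟩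
    sum {q} (λ _ → s ℕ.+ suc (suc k)) ℕ.+ (s ℕ.+ suc (suc k))
      ≡⟨ cong (ℕ._+ (s ℕ.+ suc (suc k))) (sum-const q _) ⟩
    q ℕ.* (s ℕ.+ suc (suc k)) ℕ.+ (s ℕ.+ suc (suc k))  ∎)
    where
    open ℕₚ.≤-Reasoning
    open AsMDSCode s sys mds
    open RepeatedPoint G i≢j same
    k≤n : k ≤ n
    k≤n = ℕₚ.<⇒≤ (ℕₚ.≤-pred (ℕₚ.≤-pred dimension≤length))
    w : Fin (suc k) → Vec (suc (suc (suc k)))
    w = G i ∷ λ x → G (others (inject≤ x k≤n))
    pencil = pencil-through ℕₚ.≤-refl w
    u₁ = proj₁ pencil
    u₂ = proj₁ (proj₂ pencil)
    axis⊇w = proj₁ (proj₂ (proj₂ pencil))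
    u₂≢0 = proj₁ (proj₂ (proj₂ (proj₂ pencil)))
    member≢0 = proj₂ (proj₂ (proj₂ (proj₂ pencil)))
    axis : Fin (suc (suc n)) → Bool
    axis l = onHyperplane u₁ (G l) ∧ onHyperplane u₂ (G l)
    on-axis : ∀ l → ⟨ u₁ , G l ⟩ ≡ 0# × ⟨ u₂ , G l ⟩ ≡ 0# → axis l ≡ true
    on-axis l (u₁⊥ , u₂⊥) = cong₂ _∧_ (onHyperplane⁺ u₁ (G l) u₁⊥) (onHyperplane⁺ u₂ (G l) u₂⊥)
    axis-count : suc (suc k) ≤ countTrue axis
    axis-count = 2+c≤countTrue axis (on-axis i (axis⊇w zero))
      (on-axis j (⊥-repeated u₁ (proj₁ (axis⊇w zero)) , ⊥-repeated u₂ (proj₂ (axis⊇w zero))))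
      k≤n (λ x → on-axis (others (inject≤ x k≤n)) (axis⊇w (suc x)))
    bound : ∀ {v} → Nonzero v → pointsOn G v ≤ s ℕ.+ suc (suc k)
    bound {v} v≢0 = ℕₚ.≤-pred (subst (suc (pointsOn G v) ≤_) (ℕₚ.+-suc s _) (pointsOn<s+k v v≢0))

  exceeds-pencil-bound⇒projective : ∀ {s n k d} {G : PointFamily F (suc (suc n)) k} →
                    IsProjSystem F _ k d G → IsAsMDS F s (suc (suc n)) k d →
                    2 < k → s ℕ.* (q ℕ.+ 1) ℕ.+ k ∸ 1 < suc (suc n) → Projective F G
  exceeds-pencil-bound⇒projective {s} {n} {suc (suc (suc k))} sys mds (s≤s (s≤s (s≤s _))) long =
    projective-if-no-repeats λ i≢j same →
    ℕₚ.<⇒≱ (subst (_< suc (suc n)) (ℕₚ.+-∸-assoc (s ℕ.* (q ℕ.+ 1)) {suc (suc (suc k))} (s≤s z≤n)) long)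
           (repeated-point⇒short sys mds i≢j same)

  -- Almost MDS codes

  module AMDSRepeatedPoint {n K₂ d : ℕ} {G : PointFamily F (suc (suc n)) (suc (suc (suc K₂)))}
           (sys : IsProjSystem F _ _ d G) (mds : IsAsMDS F 1 (suc (suc n)) (suc (suc (suc K₂))) d)
           {i j : Fin (suc (suc n))} (i≢j : i ≢ j) (same : SamePoint F (G i) (G j))
           (room : suc (suc (suc (suc K₂))) ≤ n) where

    open AsMDSCode 1 sys mds
    open RepeatedPoint G i≢j same

    K : ℕ
    K = suc (suc K₂)

    -- a, b and the K points p m are distinct from each other and from i and j
    E : Fin (suc (suc K)) → Fin (suc (suc n))
    E z = others (inject≤ z room)

    a b : Fin (suc (suc n))
    a = E zero
    b = E (suc zero)

    p : Fin K → Fin (suc (suc n))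
    p m = E (suc (suc m))

    count-p count-E : Vec (suc K) → ℕ
    count-p h = countTrue (λ m → onHyperplane h (G (p m)))
    count-E h = 𝟙 (onHyperplane h (G a)) ℕ.+ (𝟙 (onHyperplane h (G b)) ℕ.+ count-p h)

    -- for s = 1 a hyperplane holds at most k = K + 1 points, two of which are already G i and G j
    overfull : ∀ h → Nonzero h → ⟨ h , G i ⟩ ≡ 0# → K ≤ count-E h → ⊥
    overfull h h≢0 h⊥P full = ℕₚ.<⇒≱ (pointsOn<s+k h h≢0) (ℕₚ.≤-trans (ℕₚ.+-monoʳ-≤ 2 full)
      (pointsOn-through-≥ h (λ z → inject≤ z room) (Finₚ.inject≤-injective room room _ _) h⊥P))

    through : Fin K → Fin K → Vec (suc K)
    through m = G i ∷ λ y → G (p (punchIn m y))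

    h : Fin K → Vec (suc K)
    h m = proj₁ (hyperplane-through ℕₚ.≤-refl (through m))

    h≢0 : ∀ m → Nonzero (h m)
    h≢0 m = proj₁ (proj₂ (hyperplane-through ℕₚ.≤-refl (through m)))

    h⊥through : ∀ m x → ⟨ h m , through m x ⟩ ≡ 0#
    h⊥through m = proj₂ (proj₂ (hyperplane-through ℕₚ.≤-refl (through m)))

    h⊥p : ∀ m x → m ≢ x → ⟨ h m , G (p x) ⟩ ≡ 0#
    h⊥p m x m≢x = subst (λ y → ⟨ h m , G (p y) ⟩ ≡ 0#) (Finₚ.punchIn-punchOut m≢x)
                        (h⊥through m (suc (punchOut m≢x)))

    K₂<count-p-h : ∀ m → suc K₂ ≤ count-p (h m)
    K₂<count-p-h m = countTrue-punchIn (λ x → onHyperplane (h m) (G (p x))) m λ y →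
      onHyperplane⁺ (h m) (G (p (punchIn m y))) (h⊥p m (punchIn m y) (Finₚ.punchInᵢ≢i m y ∘ sym))

    A B : Fin K → Carrier
    A m = ⟨ h m , G a ⟩
    B m = ⟨ h m , G b ⟩

    A≢0 : ∀ m → A m ≢ 0#
    A≢0 m A≡0 = overfull (h m) (h≢0 m) (h⊥through m zero)
      (subst (λ c → K ≤ 𝟙 c ℕ.+ (𝟙 (onHyperplane (h m) (G b)) ℕ.+ count-p (h m)))
             (sym (onHyperplane⁺ (h m) (G a) A≡0))
             (s≤s (ℕₚ.≤-trans (K₂<count-p-h m) (ℕₚ.m≤n+m (count-p (h m)) (𝟙 (onHyperplane (h m) (G b)))))))

    B≢0 : ∀ m → B m ≢ 0#
    B≢0 m B≡0 = overfull (h m) (h≢0 m) (h⊥through m zero)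
      (subst (λ c → K ≤ 𝟙 (onHyperplane (h m) (G a)) ℕ.+ (𝟙 c ℕ.+ count-p (h m)))
             (sym (onHyperplane⁺ (h m) (G b) B≡0))
             (ℕₚ.≤-trans (s≤s (K₂<count-p-h m)) (ℕₚ.m≤n+m (suc (count-p (h m))) (𝟙 (onHyperplane (h m) (G a))))))

    hp≢0 : ∀ m → ⟨ h m , G (p m) ⟩ ≢ 0#
    hp≢0 m hp≡0 = overfull (h m) (h≢0 m) (h⊥through m zero)
      (ℕₚ.≤-trans (ℕₚ.≤-reflexive (sym (countTrue-all _ all)))
        (ℕₚ.≤-trans (ℕₚ.m≤n+m (count-p (h m)) (𝟙 (onHyperplane (h m) (G b))))
                    (ℕₚ.m≤n+m _ (𝟙 (onHyperplane (h m) (G a))))))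
      where
      all : ∀ x → onHyperplane (h m) (G (p x)) ≡ true
      all x with m Finₚ.≟ x
      ... | yes refl = onHyperplane⁺ (h m) (G (p x)) hp≡0
      ... | no  m≢x  = onHyperplane⁺ (h m) (G (p x)) (h⊥p m x m≢x)

    ratio : Fin K → Carrier
    ratio m = B m * inv (A m) (A≢0 m)

    -- two hyperplanes h m, h l with equal ratios span a member of their pencil through a and b
    module Combination {m l : Fin K} (m≢l : m ≢ l) (ratio≡ : ratio m ≡ ratio l) where

      f : Vec (suc K)
      f = A l *ᵥ h m -ᵥ A m *ᵥ h l

      ⟨f,_⟩ : ∀ v → ⟨ f , v ⟩ ≡ A l * ⟨ h m , v ⟩ - A m * ⟨ h l , v ⟩
      ⟨f, v ⟩ = trans (⟨⟩-subˡ (A l *ᵥ h m) (A m *ᵥ h l) v)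
                      (cong₂ _-_ (⟨⟩-scaleˡ (A l) (h m) v) (⟨⟩-scaleˡ (A m) (h l) v))

      f⊥ : ∀ v → ⟨ h m , v ⟩ ≡ 0# → ⟨ h l , v ⟩ ≡ 0# → ⟨ f , v ⟩ ≡ 0#
      f⊥ v hm⊥v hl⊥v = trans ⟨f, v ⟩ (x≈y⇒x∙y⁻¹≈ε
        (trans (cong (A l *_) hm⊥v) (trans (zeroʳ (A l)) (sym (trans (cong (A m *_) hl⊥v) (zeroʳ (A m)))))))

      f≢0 : Nonzero f
      f≢0 = ⟨⟩≢0⇒nonzeroˡ {v = G (p m)} λ f⊥pm → *-nonzero (A≢0 l) (hp≢0 m) (begin
        A l * ⟨ h m , G (p m) ⟩   ≡⟨ x∙y⁻¹≈ε⇒x≈y (A l * ⟨ h m , G (p m) ⟩) (A m * ⟨ h l , G (p m) ⟩)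
                                                (trans (sym ⟨f, G (p m) ⟩) f⊥pm) ⟩
        A m * ⟨ h l , G (p m) ⟩   ≡⟨ cong (A m *_) (h⊥p l m (m≢l ∘ sym)) ⟩
        A m * 0#                  ≡⟨ zeroʳ (A m) ⟩
        0#                        ∎)
        where open ≡-Reasoning

      f-full : K ≤ count-E f
      f-full = subst₂ (λ x y → K ≤ 𝟙 x ℕ.+ (𝟙 y ℕ.+ count-p f)) (sym f⊥a) (sym f⊥b) (s≤s (s≤s K₂≤count-p))
        where
        f⊥a = onHyperplane⁺ f (G a) (trans ⟨f, G a ⟩ (x≈y⇒x∙y⁻¹≈ε (*-comm (A l) (A m))))
        f⊥b = onHyperplane⁺ f (G b) (trans ⟨f, G b ⟩ (x≈y⇒x∙y⁻¹≈ε (cross-multiply (A≢0 m) (A≢0 l) ratio≡)))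
        l′ = punchOut m≢l
        f⊥rest : ∀ y → onHyperplane f (G (p (punchIn m (punchIn l′ y)))) ≡ true
        f⊥rest y = onHyperplane⁺ f (G (p x))
          (f⊥ (G (p x)) (h⊥p m x (Finₚ.punchInᵢ≢i m (punchIn l′ y) ∘ sym)) (h⊥p l x l≢x))
          where
          x = punchIn m (punchIn l′ y)
          l≢x : l ≢ x
          l≢x eq = Finₚ.punchInᵢ≢i l′ y (sym (Finₚ.punchIn-injective m _ _ (trans (Finₚ.punchIn-punchOut m≢l) eq)))
        K₂≤count-p : K₂ ≤ count-p f
        K₂≤count-p = ℕₚ.≤-trans (countTrue-punchIn (λ x → onHyperplane f (G (p (punchIn m x)))) l′ f⊥rest)
          (subst (countTrue (λ x → onHyperplane f (G (p (punchIn m x)))) ≤_)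
                 (sym (countTrue-remove m (λ x → onHyperplane f (G (p x)))))
                 (ℕₚ.m≤n+m _ (𝟙 (onHyperplane f (G (p m))))))

    q≤K⇒⊥ : q ≤ K → ⊥
    q≤K⇒⊥ q≤K =
      let m , l , m≢l , ratio≡ = pigeonhole-nonzero q≤K ratio (λ m → *-nonzero (B≢0 m) (inv-nonzero (A m) (A≢0 m)))
          open Combination m≢l ratio≡
      in overfull f f≢0 (f⊥ (G i) (h⊥through m zero) (h⊥through l zero)) f-full

  AMDS-longer-than-k+2⇒projective : ∀ {s n k d} {G : PointFamily F (suc (suc n)) (suc (suc k))} →
    IsProjSystem F _ _ d G → IsAsMDS F s (suc (suc n)) (suc (suc k)) d →
    s ≡ 1 → q < suc (suc k) → suc (suc k) ℕ.+ 2 < suc (suc n) → Projective F G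
  AMDS-longer-than-k+2⇒projective {k = zero} _ _ _ q<2 _ = ⊥-elim (ℕₚ.<⇒≱ q<2 2≤q)
  AMDS-longer-than-k+2⇒projective {n = n} {suc K₂} {G = G} sys mds refl q<k long =
    projective-if-no-repeats λ i≢j same → AMDSRepeatedPoint.q≤K⇒⊥ {G = G} sys mds i≢j same room (ℕₚ.≤-pred q<k)
    where
    room : suc (suc (suc (suc K₂))) ≤ n
    room = subst (_≤ n) (cong (λ x → suc (suc x)) (ℕₚ.+-comm K₂ 2)) (ℕₚ.≤-pred (ℕₚ.≤-pred long))

  -- Projection from a repeated point

  nonzeroOr : ∀ {k} → Vec k → Vec k → Vec k
  nonzeroOr Q v with Finₚ.all? (λ t → v t ≟ 0#)
  ... | yes _ = Q
  ... | no  _ = v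

  nonzeroOr-nonzero : ∀ {k} {Q : Vec k} v → Nonzero Q → Nonzero (nonzeroOr Q v)
  nonzeroOr-nonzero v Q≢0 with Finₚ.all? (λ t → v t ≟ 0#)
  ... | yes _   = Q≢0
  ... | no  v≢0 = v≢0

  ⊥-nonzeroOr⁻ : ∀ {k} (u Q v : Vec k) → ⟨ u , nonzeroOr Q v ⟩ ≡ 0# → ⟨ u , v ⟩ ≡ 0#
  ⊥-nonzeroOr⁻ u Q v u⊥ with Finₚ.all? (λ t → v t ≟ 0#)
  ... | yes v≡0 = ⟨⟩-zeroʳ u v v≡0
  ... | no  _   = u⊥

  ⊥-nonzeroOr⁺ : ∀ {k} (u Q v : Vec k) → ⟨ u , Q ⟩ ≡ 0# → ⟨ u , v ⟩ ≡ 0# → ⟨ u , nonzeroOr Q v ⟩ ≡ 0#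
  ⊥-nonzeroOr⁺ u Q v u⊥Q u⊥v with Finₚ.all? (λ t → v t ≟ 0#)
  ... | yes _ = u⊥Q
  ... | no  _ = u⊥v

  module Padding {s n K : ℕ} (g : Fin n → Vec (suc (suc K)))
                 (spanning : ∀ u → Nonzero u → ∃ λ y → ⟨ u , g y ⟩ ≢ 0#)
                 (bounded : ∀ u → Nonzero u → pointsOn g u < s ℕ.+ suc (suc K)) where

    private
      k T : ℕ
      k = suc (suc K)
      T = s ℕ.+ suc K

      nonzero? : ∀ (u : Vec k) → Dec (Nonzero u)
      nonzero? u = ¬? (Finₚ.all? (λ t → u t ≟ 0#))

      fullest = maximum-attained Nonzero (pointsOn g) n
        (λ b → any?-Vec (λ u → Nonzero u × b ≤ pointsOn g u)
                        (λ u≗v (u≢0 , b≤) → (λ v≡0 → u≢0 (λ t → trans (u≗v t) (v≡0 t))) ,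
                                             subst (b ≤_) (pointsOn-cong g u≗v) b≤)
                        (λ u → nonzero? u ×-dec (b ℕ.≤? pointsOn g u)))
        (λ u _ → countTrue≤n _) (unit zero , unit-nonzero zero)

    v₀ : Vec k
    v₀ = proj₁ fullest

    v₀≢0 : Nonzero v₀
    v₀≢0 = proj₁ (proj₂ fullest)

    C : ℕ
    C = pointsOn g v₀

    C≤T : C ≤ T
    C≤T = ℕₚ.≤-pred (subst (suc C ≤_) (ℕₚ.+-suc s (suc K)) (bounded v₀ v₀≢0))

    Q : Vec k
    Q = proj₁ (hyperplane-through (s≤s (s≤s z≤n)) (λ _ → v₀))

    Q≢0 : Nonzero Q
    Q≢0 = proj₁ (proj₂ (hyperplane-through (s≤s (s≤s z≤n)) (λ _ → v₀)))

    v₀⊥Q : ⟨ v₀ , Q ⟩ ≡ 0#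
    v₀⊥Q = trans (⟨⟩-comm v₀ Q) (proj₂ (proj₂ (hyperplane-through (s≤s (s≤s z≤n)) (λ _ → v₀))) zero)

    -- the zero vectors of g are replaced by Q, and T ∸ C copies of Q fill v₀ up to T points
    r : ℕ
    r = T ∸ C

    padded : PointFamily F (r ℕ.+ n) k
    padded = replicate r Q ++ λ y → nonzeroOr Q (g y)

    pointsOn-padded : ∀ u → pointsOn padded u ≡ r ℕ.* 𝟙 (onHyperplane u Q) ℕ.+ pointsOn (nonzeroOr Q ∘ g) u
    pointsOn-padded u = trans (countTrue-++ (onHyperplane u) (replicate r Q) (nonzeroOr Q ∘ g))
                              (cong (ℕ._+ pointsOn (nonzeroOr Q ∘ g) u) (sum-const r _))

    r+C≡T : r ℕ.+ C ≡ T
    r+C≡T = ℕₚ.m∸n+n≡m C≤T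

    pointsOn-padded≤T : ∀ u → Nonzero u → pointsOn padded u ≤ T
    pointsOn-padded≤T u u≢0 = begin
      pointsOn padded u                                                   ≡⟨ pointsOn-padded u ⟩
      r ℕ.* 𝟙 (onHyperplane u Q) ℕ.+ pointsOn (nonzeroOr Q ∘ g) u       ≤⟨ ℕₚ.+-mono-≤ copies others ⟩
      r ℕ.+ C                                                             ≡⟨ r+C≡T ⟩
      T                                                                   ∎
      where
      open ℕₚ.≤-Reasoning
      copies = subst (r ℕ.* 𝟙 (onHyperplane u Q) ≤_) (ℕₚ.*-identityʳ r) (ℕₚ.*-monoʳ-≤ r (𝟙≤1 _))
      others = ℕₚ.≤-trans
        (countTrue-mono λ y on → onHyperplane⁺ u (g y) (⊥-nonzeroOr⁻ u Q (g y) (onHyperplane⁻ u (nonzeroOr Q (g y)) on)))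
        (proj₂ (proj₂ fullest) u u≢0)

    pointsOn-padded-v₀ : pointsOn padded v₀ ≡ T
    pointsOn-padded-v₀ = begin
      pointsOn padded v₀                                                  ≡⟨ pointsOn-padded v₀ ⟩
      r ℕ.* 𝟙 (onHyperplane v₀ Q) ℕ.+ pointsOn (nonzeroOr Q ∘ g) v₀      ≡⟨ cong₂ ℕ._+_ copies others ⟩
      r ℕ.+ C                                                             ≡⟨ r+C≡T ⟩
      T                                                                   ∎
      where
      open ≡-Reasoning
      copies = trans (cong (λ b → r ℕ.* 𝟙 b) (onHyperplane⁺ v₀ Q v₀⊥Q)) (ℕₚ.*-identityʳ r)
      others = ℕₚ.≤-antisym
        (countTrue-mono λ y on →
           onHyperplane⁺ v₀ (g y) (⊥-nonzeroOr⁻ v₀ Q (g y) (onHyperplane⁻ v₀ (nonzeroOr Q (g y)) on)))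
        (countTrue-mono λ y on →
           onHyperplane⁺ v₀ (nonzeroOr Q (g y)) (⊥-nonzeroOr⁺ v₀ Q (g y) v₀⊥Q (onHyperplane⁻ v₀ (g y) on)))

    extension : Σ[ N ∈ ℕ ] n ≤ N × ExistsAsMDS F s k N
    extension = r ℕ.+ n , ℕₚ.m≤n+m n r , d′ , padded , (allPoints , nonDegenerate , hasMinDist) ,
                AsMDS-length s K d′ (r ℕ.+ n) (ℕₚ.m+[n∸m]≡n T≤N)
      where
      T≤N : T ≤ r ℕ.+ n
      T≤N = subst (_≤ r ℕ.+ n) r+C≡T (ℕₚ.+-monoʳ-≤ r (countTrue≤n _))
      d′ = r ℕ.+ n ∸ T
      allPoints : AllPoints F padded
      allPoints = ++-all Nonzero (replicate r Q) (nonzeroOr Q ∘ g) (λ _ → Q≢0) (λ y → nonzeroOr-nonzero (g y) Q≢0)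
      nonDegenerate : NonDegenerate F padded
      nonDegenerate u u≢0 = r ↑ʳ y , λ u⊥ → u·gy≢0 (⊥-nonzeroOr⁻ u Q (g y)
        (subst (λ w → ⟨ u , w ⟩ ≡ 0#) (lookup-++ʳ (replicate r Q) (nonzeroOr Q ∘ g) y) u⊥))
        where
        y = proj₁ (spanning u u≢0)
        u·gy≢0 = proj₂ (spanning u u≢0)
      hasMinDist : HasMinDist F padded d′
      hasMinDist =
        (v₀ , v₀≢0 , trans (cong (ℕ._+ d′) (trans (hyperplaneCount≡pointsOn padded v₀) pointsOn-padded-v₀))
                           (ℕₚ.m+[n∸m]≡n T≤N)) ,
        λ u u≢0 → subst (hyperplaneCount F padded u ℕ.+ d′ ≤_) (ℕₚ.m+[n∸m]≡n T≤N)
          (ℕₚ.+-monoˡ-≤ d′ (subst (_≤ T) (sym (hyperplaneCount≡pointsOn padded u)) (pointsOn-padded≤T u u≢0)))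

  -- π projects from P; by ⟨⟩-π, lift identifies hyperplanes of the quotient with hyperplanes through P
  module Projection {K : ℕ} (P : Vec (suc K)) {t : Fin (suc K)} (Pt≢0 : P t ≢ 0#) where

    private
      P′ : Vec K
      P′ = P ∘ punchIn t

    π : Vec (suc K) → Vec K
    π v = P t *ᵥ (v ∘ punchIn t) -ᵥ v t *ᵥ P′

    lift : Vec K → Vec (suc K)
    lift u = insertAt (P t *ᵥ u) t (- ⟨ u , P′ ⟩)

    ⟨lift⟩ : ∀ u v → ⟨ lift u , v ⟩ ≡ P t * ⟨ u , v ∘ punchIn t ⟩ - ⟨ u , P′ ⟩ * v t
    ⟨lift⟩ u v = begin
      ⟨ lift u , v ⟩                                ≡⟨ ⟨⟩-remove t (lift u) v ⟩
      lift u t * v t + ⟨ lift u ∘ punchIn t , v′ ⟩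
        ≡⟨ cong₂ (λ x y → x * v t + y) (insertAt-lookup (P t *ᵥ u) t (- S))
                 (⟨⟩-cong {u = lift u ∘ punchIn t} {u′ = P t *ᵥ u} {v = v′} {v′ = v′}
                          (insertAt-punchIn (P t *ᵥ u) t (- S)) (λ _ → refl)) ⟩
      - S * v t + ⟨ P t *ᵥ u , v′ ⟩                 ≡⟨ cong₂ _+_ (sym (-‿distribˡ-* S (v t))) (⟨⟩-scaleˡ (P t) u v′) ⟩
      - (S * v t) + P t * ⟨ u , v′ ⟩               ≡⟨ +-comm _ _ ⟩
      P t * ⟨ u , v′ ⟩ - S * v t                   ∎
      where
      open ≡-Reasoning
      S = ⟨ u , P′ ⟩
      v′ = v ∘ punchIn t

    ⟨⟩-π : ∀ u v → ⟨ u , π v ⟩ ≡ ⟨ lift u , v ⟩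
    ⟨⟩-π u v = begin
      ⟨ u , π v ⟩                                   ≡⟨ ⟨⟩-subʳ u (P t *ᵥ v′) (v t *ᵥ P′) ⟩
      ⟨ u , P t *ᵥ v′ ⟩ - ⟨ u , v t *ᵥ P′ ⟩         ≡⟨ cong₂ _-_ (⟨⟩-scaleʳ u (P t) v′) (⟨⟩-scaleʳ u (v t) P′) ⟩
      P t * ⟨ u , v′ ⟩ - v t * ⟨ u , P′ ⟩           ≡⟨ cong (λ x → P t * ⟨ u , v′ ⟩ - x) (*-comm (v t) _) ⟩
      P t * ⟨ u , v′ ⟩ - ⟨ u , P′ ⟩ * v t           ≡⟨ ⟨lift⟩ u v ⟨
      ⟨ lift u , v ⟩                                ∎
      where
      open ≡-Reasoning
      v′ = v ∘ punchIn t

    lift⊥P : ∀ u → ⟨ lift u , P ⟩ ≡ 0#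
    lift⊥P u = trans (⟨lift⟩ u P) (x≈y⇒x∙y⁻¹≈ε (*-comm (P t) ⟨ u , P′ ⟩))

    lift-nonzero : ∀ {u} → Nonzero u → Nonzero (lift u)
    lift-nonzero {u} u≢0 lift≡0 = u≢0 λ y → *-cancelˡ-0 (u y) Pt≢0
      (trans (sym (insertAt-punchIn (P t *ᵥ u) t (- ⟨ u , P′ ⟩) y)) (lift≡0 (punchIn t y)))

  repeated-point⇒longer-code : ∀ {s n K₂ d} {G : PointFamily F (suc (suc n)) (suc (suc (suc K₂)))} →
    IsProjSystem F _ _ d G → IsAsMDS F (suc s) (suc (suc n)) (suc (suc (suc K₂))) d →
    ∀ {i j} → i ≢ j → SamePoint F (G i) (G j) → Σ[ N ∈ ℕ ] n ≤ N × ExistsAsMDS F s (suc (suc K₂)) N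
  repeated-point⇒longer-code {s} {n} {K₂} {G = G} sys mds {i} {j} i≢j same =
    Padding.extension (π ∘ G ∘ others) spanning bounded
    where
    open AsMDSCode (suc s) sys mds
    open RepeatedPoint G i≢j same
    open Projection (G i) (proj₂ (nonzero-coordinate (proj₁ sys i)))

    spanning : ∀ u → Nonzero u → ∃ λ y → ⟨ u , π (G (others y)) ⟩ ≢ 0#
    spanning u u≢0 = y , λ u⊥ → lift-off (subst (λ l → ⟨ lift u , G l ⟩ ≡ 0#) others-y≡l
                                                 (trans (sym (⟨⟩-π u (G (others y)))) u⊥))
      where
      off = proj₁ (proj₂ sys) (lift u) (lift-nonzero u≢0)
      l = proj₁ off
      lift-off = proj₂ off
      l≢i : l ≢ i
      l≢i l≡i = lift-off (subst (λ l → ⟨ lift u , G l ⟩ ≡ 0#) (sym l≡i) (lift⊥P u))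
      l≢j : l ≢ j
      l≢j l≡j = lift-off (subst (λ l → ⟨ lift u , G l ⟩ ≡ 0#) (sym l≡j) (⊥-repeated (lift u) (lift⊥P u)))
      y = proj₁ (others-surjective l l≢i l≢j)
      others-y≡l = proj₂ (others-surjective l l≢i l≢j)

    bounded : ∀ u → Nonzero u → pointsOn (π ∘ G ∘ others) u < s ℕ.+ suc (suc K₂)
    bounded u u≢0 = ℕₚ.≤-pred (begin
      suc (suc (pointsOn (π ∘ G ∘ others) u))
        ≡⟨ cong (λ c → suc (suc c)) (countTrue-cong (λ y → cong isZero (⟨⟩-π u (G (others y))))) ⟩
      2 ℕ.+ countTrue (λ y → onHyperplane (lift u) (G (others y)))
        ≤⟨ pointsOn-through-≥ (lift u) (λ y → y) (λ eq → eq) (lift⊥P u) ⟩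
      pointsOn G (lift u)
        ≤⟨ ℕₚ.≤-pred (pointsOn<s+k (lift u) (lift-nonzero u≢0)) ⟩
      s ℕ.+ suc (suc (suc K₂))
        ≡⟨ ℕₚ.+-suc s _ ⟩
      suc (s ℕ.+ suc (suc K₂))  ∎)
      where open ℕₚ.≤-Reasoning

  longer-than-maximum⇒projective : ∀ {s n k d} {G : PointFamily F (suc (suc n)) k} →
    IsProjSystem F _ k d G → IsAsMDS F s (suc (suc n)) k d →
    0 < s → 2 < k → Σ[ m ∈ ℕ ] IsMaxLength F (s ∸ 1) (k ∸ 1) m × m ℕ.+ 2 < suc (suc n) → Projective F G
  longer-than-maximum⇒projective {suc s} {n} {suc (suc (suc k))} sys mds (s≤s _) (s≤s (s≤s (s≤s _)))
                                 (m , maximal , long) = projective-if-no-repeats λ i≢j same →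
      let N , n≤N , code = repeated-point⇒longer-code sys mds i≢j same
      in ℕₚ.<⇒≱ (ℕₚ.≤-pred (ℕₚ.≤-pred (subst (_< suc (suc n)) (ℕₚ.+-comm m 2) long)))
                (ℕₚ.≤-trans n≤N (proj₂ maximal N code))

-- opened only here: inside Geometry these names are the field operations
open import Data.Nat using (_+_; _*_)

mainTheorem3 : (q : ℕ) (F : FiniteField q) (n k d s : ℕ) (G : PointFamily F n k)
    → IsProjSystem F n k d G → IsAsMDS F s n k d → 2 ≤ k
    → (s ≡ 0 → Projective F G)
    × (k ≡ 2 → (Projective F G ⇔ s ≡ 0))
    × (0 < s → 2 < k → Σ ℕ (λ m → IsMaxLength F (s ∸ 1) (k ∸ 1) m × m + 2 < n) → Projective F G)
    × (2 < k → s * (q + 1) + k ∸ 1 < n → Projective F G)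
    × (s ≡ 1 → q < k → k + 2 < n → Projective F G)
mainTheorem3 q F n (suc (suc k)) d s G sys mds 2≤k@(s≤s (s≤s _))
  with ℕₚ.≤-trans 2≤k (Geometry.AsMDSCode.dimension≤length F s sys mds)
... | s≤s (s≤s _) =
  MDS⇒projective sys mds ,
  projective-line⇔MDS sys mds ,
  longer-than-maximum⇒projective sys mds ,
  exceeds-pencil-bound⇒projective sys mds ,
  AMDS-longer-than-k+2⇒projective sys mds
  where open Geometry F
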